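{- The 4-dimensional hypercube graph $Q_4$ is an integral sum graph and has infinitely many primitive labellings.
   Context: $Q_4$ is the graph with vertex set $\{0,1\}^4$, two vertices adjacent if they differ in exactly one coordinate. A graph $G$ is an integral sum graph ($\mathbb{Z}$-graph) if there is an injective map $\lambda:V(G)\to\mathbb{Z}$ (a labelling) such that two distinct vertices $u,v$ are adjacent if and only if $\lambda(u)+\lambda(v)\in\lambda(V(G))$. A labelling is primitive if it is not equal to $c\mu$ for some labelling $\mu$ of $G$ and some integer $c$ with $|c|>1$. -}

module Defs where

open import Data.Bool using (Bool; true; false)
open import Data.Nat using (ℕ; zero; suc)
open import Data.Integer using (ℤ; _+_; _*_; ∣_∣)
open import Data.Vec using (Vec; []; _∷_)
open import Data.Product using (Σ; ∃; _×_)
open import Relation.Binary.PropositionalEquality using (_≡_)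
open import Relation.Nullary using (¬_)
open import Function.Bundles using (_⇔_)
open import Data.Nat using (_<_)

V : Set
V = Vec Bool 4

bdiff : Bool → Bool → ℕ
bdiff true  false = 1
bdiff false true  = 1
bdiff _     _     = 0

hamming : ∀ {n} → Vec Bool n → Vec Bool n → ℕ
hamming []       []       = 0
hamming (x ∷ xs) (y ∷ ys) = bdiff x y Data.Nat.+ hamming xs ys

Adj : V → V → Set
Adj u v = hamming u v ≡ 1

IsLabelling : (V → ℤ) → Set
IsLabelling l =
  (∀ u v → l u ≡ l v → u ≡ v) ×
  (∀ u v → ¬ (u ≡ v) → (Adj u v ⇔ (∃ λ w → l u + l v ≡ l w)))

IsIntegralSumGraph : Set
IsIntegralSumGraph = Σ (V → ℤ) IsLabelling

IsPrimitive : (V → ℤ) → Set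
IsPrimitive l = IsLabelling l ×
  ¬ (Σ (V → ℤ) λ μ → Σ ℤ λ c → IsLabelling μ × (1 < ∣ c ∣) × (∀ v → l v ≡ c * μ v))

InfinitelyManyPrimitive : Set
InfinitelyManyPrimitive =
  Σ (ℕ → V → ℤ) λ f →
    (∀ n → IsPrimitive (f n)) ×
    (∀ m n → ¬ (m ≡ n) → ¬ (∀ v → f m v ≡ f n v))

{-# OPTIONS --safe #-}
-- Place the vertices of Q₄ at lattice points (x v , y v) ∈ ℤ² so that Q₄ is a sum
-- graph over ℤ² (checked exhaustively).  The additive map (x , y) ↦ x t + y sends a
-- nonzero point with |y| < t to a nonzero integer; once t > 3 max |y v| this applies
-- to every p u + p v − p w and p u − p v, so x t + y is a labelling of Q₄ for each
-- such t.  Two vertices sit at (0 , 3) and (0 , 2), so their labels differ by 1 and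
-- no labelling obtained this way is a proper multiple; the vertex at (1 , 0) has
-- label t, so different t give different labellings.
module Submission where

open import Defs
open import Data.Product using (_×_)
open import Data.Bool using (Bool; true; false)
open import Data.Nat as ℕ using (ℕ; zero; suc; _≤_; _<_)
import Data.Nat.Properties as ℕP
open import Data.Integer using (ℤ; +_; -_; _+_; _*_; _-_; ∣_∣; 0ℤ; 1ℤ)
import Data.Integer as ℤ
import Data.Integer.Properties as ℤP
open import Data.Integer.Tactic.RingSolver using (solve-∀)
import Data.Nat.Tactic.RingSolver as ℕSolver
open import Data.Vec using (Vec; []; _∷_)
import Data.Vec.Properties as VecP
import Data.Bool.Properties as BoolP
open import Data.Product using (∃; _,_; proj₁; proj₂)
open import Data.Sum using (inj₁; inj₂)
open import Function using (_∘_)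
open import Function.Bundles using (_⇔_; mk⇔; Equivalence)
open import Relation.Binary.PropositionalEquality
open import Relation.Binary.Definitions using (DecidableEquality)
open import Relation.Nullary using (¬_; Dec; ¬?)
open import Relation.Nullary.Decidable using (map′; _×-dec_; _⊎-dec_; _→-dec_; from-yes)
import Relation.Unary as U

all? : ∀ {n p} {P : U.Pred (Vec Bool n) p} → U.Decidable P → Dec (∀ v → P v)
all? {zero}  P? = map′ (λ p → λ { [] → p }) (λ h → h []) (P? [])
all? {suc n} P? =
  map′ (λ (t , f) → λ { (true ∷ v) → t v ; (false ∷ v) → f v })
       (λ h → h ∘ (true ∷_) , h ∘ (false ∷_))
       (all? (P? ∘ (true ∷_)) ×-dec all? (P? ∘ (false ∷_)))

any? : ∀ {n p} {P : U.Pred (Vec Bool n) p} → U.Decidable P → Dec (∃ P)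
any? {zero}  P? = map′ ([] ,_) (λ { ([] , p) → p }) (P? [])
any? {suc n} P? =
  map′ (λ { (inj₁ (v , p)) → true ∷ v , p ; (inj₂ (v , p)) → false ∷ v , p })
       (λ { (true ∷ v , p) → inj₁ (v , p) ; (false ∷ v , p) → inj₂ (v , p) })
       (any? (P? ∘ (true ∷_)) ⊎-dec any? (P? ∘ (false ∷_)))

_⇔-dec_ : ∀ {a b} {A : Set a} {B : Set b} → Dec A → Dec B → Dec (A ⇔ B)
A? ⇔-dec B? = map′ (λ (f , g) → mk⇔ f g) (λ e → Equivalence.to e , Equivalence.from e)
                   ((A? →-dec B?) ×-dec (B? →-dec A?))

_≟ᵥ_ : DecidableEquality V
_≟ᵥ_ = VecP.≡-dec BoolP._≟_

adj? : ∀ u v → Dec (Adj u v)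
adj? u v = hamming u v ℕ.≟ 1

IsPlanarSum : (V → ℤ) → (V → ℤ) → V → V → V → Set
IsPlanarSum x y u v w = x u + x v ≡ x w × y u + y v ≡ y w

IsPlanarLabelling : (V → ℤ) → (V → ℤ) → Set
IsPlanarLabelling x y =
  (∀ u v → x u ≡ x v → y u ≡ y v → u ≡ v) ×
  (∀ u v → ¬ (u ≡ v) → (Adj u v ⇔ ∃ (IsPlanarSum x y u v)))

isPlanarLabelling? : ∀ x y → Dec (IsPlanarLabelling x y)
isPlanarLabelling? x y =
  all? (λ u → all? λ v → (x u ℤ.≟ x v) →-dec ((y u ℤ.≟ y v) →-dec (u ≟ᵥ v)))
  ×-dec
  all? (λ u → all? λ v → ¬? (u ≟ᵥ v) →-dec (adj? u v ⇔-dec any? (planarSum? u v)))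
  where
  planarSum? : ∀ u v w → Dec (IsPlanarSum x y u v w)
  planarSum? u v w = (x u + x v ℤ.≟ x w) ×-dec (y u + y v ℤ.≟ y w)

embed : ℕ → ℤ → ℤ → ℤ
embed t a b = a * + t + b

embed-+ : ∀ t a b c d → embed t a b + embed t c d ≡ embed t (a + c) (b + d)
embed-+ t a b c d = linear a b c d (+ t)
  where
  linear : ∀ a b c d t → (a * t + b) + (c * t + d) ≡ (a + c) * t + (b + d)
  linear = solve-∀

embed-- : ∀ t a b c d → embed t a b - embed t c d ≡ embed t (a - c) (b - d)
embed-- t a b c d = linear a b c d (+ t)
  where
  linear : ∀ a b c d t → (a * t + b) - (c * t + d) ≡ (a - c) * t + (b - d)
  linear = solve-∀

embed≡0⇒≡0 : ∀ {t} a b → ∣ b ∣ < t → embed t a b ≡ 0ℤ → a ≡ 0ℤ × b ≡ 0ℤ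
embed≡0⇒≡0 {t} a b ∣b∣<t eq = a≡0 , trans (sym (ℤP.+-identityˡ b)) (subst (λ a → embed t a b ≡ 0ℤ) a≡0 eq)
  where
  a*t≡-b : a * + t ≡ - b
  a*t≡-b = ℤP.i-j≡0⇒i≡j _ _ (trans (cong (λ z → a * + t + z) (ℤP.neg-involutive b)) eq)
  ∣a∣t<t : ∣ a ∣ ℕ.* t < 1 ℕ.* t
  ∣a∣t<t = begin-strict
    ∣ a ∣ ℕ.* t    ≡⟨ sym (ℤP.abs-* a (+ t)) ⟩
    ∣ a * + t ∣    ≡⟨ cong ∣_∣ a*t≡-b ⟩
    ∣ - b ∣        ≡⟨ ℤP.∣-i∣≡∣i∣ b ⟩
    ∣ b ∣          <⟨ ∣b∣<t ⟩
    t              ≡⟨ sym (ℕP.*-identityˡ t) ⟩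
    1 ℕ.* t        ∎
    where open ℕP.≤-Reasoning
  a≡0 : a ≡ 0ℤ
  a≡0 = ℤP.∣i∣≡0⇒i≡0 (ℕP.n<1⇒n≡0 (ℕP.*-cancelʳ-< t ∣ a ∣ 1 ∣a∣t<t))

embed-injective : ∀ {t} a b c d → ∣ b - d ∣ < t → embed t a b ≡ embed t c d → a ≡ c × b ≡ d
embed-injective {t} a b c d ∣b-d∣<t eq =
  ℤP.i-j≡0⇒i≡j a c (proj₁ differences≡0) , ℤP.i-j≡0⇒i≡j b d (proj₂ differences≡0)
  where
  differences≡0 : a - c ≡ 0ℤ × b - d ≡ 0ℤ
  differences≡0 = embed≡0⇒≡0 (a - c) (b - d) ∣b-d∣<t
                    (trans (sym (embed-- t a b c d)) (ℤP.i≡j⇒i-j≡0 eq))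

module _ {y : V → ℤ} {B : ℕ} (bounded : ∀ v → ∣ y v ∣ ≤ B) where

  ∣y-y∣≤3B : ∀ u v → ∣ y u - y v ∣ ≤ 3 ℕ.* B
  ∣y-y∣≤3B u v = begin
    ∣ y u - y v ∣      ≤⟨ ℤP.∣i-j∣≤∣i∣+∣j∣ (y u) (y v) ⟩
    ∣ y u ∣ ℕ.+ ∣ y v ∣  ≤⟨ ℕP.+-mono-≤ (bounded u) (bounded v) ⟩
    B ℕ.+ B            ≤⟨ ℕP.+-monoʳ-≤ B (ℕP.m≤m+n B (B ℕ.+ 0)) ⟩
    3 ℕ.* B            ∎
    where open ℕP.≤-Reasoning

  ∣y+y-y∣≤3B : ∀ u v w → ∣ y u + y v - y w ∣ ≤ 3 ℕ.* B
  ∣y+y-y∣≤3B u v w = begin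
    ∣ y u + y v - y w ∣                ≤⟨ ℤP.∣i-j∣≤∣i∣+∣j∣ (y u + y v) (y w) ⟩
    ∣ y u + y v ∣ ℕ.+ ∣ y w ∣            ≤⟨ ℕP.+-monoˡ-≤ ∣ y w ∣ (ℤP.∣i+j∣≤∣i∣+∣j∣ (y u) (y v)) ⟩
    ∣ y u ∣ ℕ.+ ∣ y v ∣ ℕ.+ ∣ y w ∣      ≤⟨ ℕP.+-mono-≤ (ℕP.+-mono-≤ (bounded u) (bounded v)) (bounded w) ⟩
    B ℕ.+ B ℕ.+ B                      ≡⟨ 3B≡ B ⟩
    3 ℕ.* B                            ∎
    where
    open ℕP.≤-Reasoning
    3B≡ : ∀ B → B ℕ.+ B ℕ.+ B ≡ 3 ℕ.* B
    3B≡ = ℕSolver.solve-∀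

embed-isLabelling : ∀ {x y B t} → IsPlanarLabelling x y → (∀ v → ∣ y v ∣ ≤ B) → 3 ℕ.* B < t →
                    IsLabelling (λ v → embed t (x v) (y v))
embed-isLabelling {x} {y} {B} {t} (planar-injective , adj⇔planarSum) bounded 3B<t =
  injective , λ u v u≢v → mk⇔ (sum u v u≢v) (adjacent u v u≢v)
  where
  l : V → ℤ
  l v = embed t (x v) (y v)

  injective : ∀ u v → l u ≡ l v → u ≡ v
  injective u v eq =
    let x≡ , y≡ = embed-injective (x u) (y u) (x v) (y v)
                    (ℕP.≤-<-trans (∣y-y∣≤3B {y} bounded u v) 3B<t) eq
    in planar-injective u v x≡ y≡

  sum : ∀ u v → ¬ u ≡ v → Adj u v → ∃ λ w → l u + l v ≡ l w
  sum u v u≢v adj =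
    let w , x-sum , y-sum = Equivalence.to (adj⇔planarSum u v u≢v) adj
    in w , trans (embed-+ t (x u) (y u) (x v) (y v)) (cong₂ (embed t) x-sum y-sum)

  adjacent : ∀ u v → ¬ u ≡ v → (∃ λ w → l u + l v ≡ l w) → Adj u v
  adjacent u v u≢v (w , eq) =
    Equivalence.from (adj⇔planarSum u v u≢v)
      (w , embed-injective (x u + x v) (y u + y v) (x w) (y w)
             (ℕP.≤-<-trans (∣y+y-y∣≤3B {y} bounded u v w) 3B<t)
             (trans (sym (embed-+ t (x u) (y u) (x v) (y v))) eq))

unitGap⇒isPrimitive : ∀ {l} → IsLabelling l → ∀ u v → l u - l v ≡ 1ℤ → IsPrimitive l
unitGap⇒isPrimitive {l} isLabelling u v gap =
  isLabelling , λ (μ , c , _ , 1<∣c∣ , l≡cμ) → ℕP.<-irrefl (sym (∣c∣≡1 μ c l≡cμ)) 1<∣c∣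
  where
  factor : ∀ c a b → c * a - c * b ≡ c * (a - b)
  factor = solve-∀
  ∣c∣≡1 : ∀ μ c → (∀ v → l v ≡ c * μ v) → ∣ c ∣ ≡ 1
  ∣c∣≡1 μ c l≡cμ = ℕP.m*n≡1⇒m≡1 ∣ c ∣ ∣ μ u - μ v ∣ (begin
    ∣ c ∣ ℕ.* ∣ μ u - μ v ∣   ≡⟨ sym (ℤP.abs-* c (μ u - μ v)) ⟩
    ∣ c * (μ u - μ v) ∣       ≡⟨ cong ∣_∣ (sym (factor c (μ u) (μ v))) ⟩
    ∣ c * μ u - c * μ v ∣     ≡⟨ cong ∣_∣ (cong₂ _-_ (sym (l≡cμ u)) (sym (l≡cμ v))) ⟩
    ∣ l u - l v ∣             ≡⟨ cong ∣_∣ gap ⟩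
    1                         ∎)
    where open ≡-Reasoning

point : V → ℤ × ℤ
point (false ∷ false ∷ false ∷ false ∷ []) = - + 1 , - + 1
point (true  ∷ false ∷ false ∷ false ∷ []) =   + 0 ,   + 3
point (false ∷ true  ∷ false ∷ false ∷ []) =   + 0 ,   + 7
point (true  ∷ true  ∷ false ∷ false ∷ []) =   + 1 ,   + 0
point (false ∷ false ∷ true  ∷ false ∷ []) =   + 1 ,   + 3
point (true  ∷ false ∷ true  ∷ false ∷ []) =   + 0 ,   + 4
point (false ∷ true  ∷ true  ∷ false ∷ []) =   + 0 , - + 3
point (true  ∷ true  ∷ true  ∷ false ∷ []) = - + 1 ,   + 2
point (false ∷ false ∷ false ∷ true  ∷ []) =   + 1 ,   + 7
point (true  ∷ false ∷ false ∷ true  ∷ []) =   + 0 , - + 6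
point (false ∷ true  ∷ false ∷ true  ∷ []) =   + 0 , - + 4
point (true  ∷ true  ∷ false ∷ true  ∷ []) = - + 1 ,   + 6
point (false ∷ false ∷ true  ∷ true  ∷ []) = - + 1 ,   + 0
point (true  ∷ false ∷ true  ∷ true  ∷ []) =   + 0 ,   + 2
point (false ∷ true  ∷ true  ∷ true  ∷ []) =   + 0 ,   + 6
point (true  ∷ true  ∷ true  ∷ true  ∷ []) =   + 1 ,   + 1

px py : V → ℤ
px = proj₁ ∘ point
py = proj₂ ∘ point

point-isPlanarLabelling : IsPlanarLabelling px py
point-isPlanarLabelling = from-yes (isPlanarLabelling? px py)

∣py∣≤7 : ∀ v → ∣ py v ∣ ≤ 7
∣py∣≤7 = from-yes (all? λ v → ∣ py v ∣ ℕ.≤? 7)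

labelling : ℕ → V → ℤ
labelling n v = embed (22 ℕ.+ n) (px v) (py v)

labelling-isLabelling : ∀ n → IsLabelling (labelling n)
labelling-isLabelling n = embed-isLabelling point-isPlanarLabelling ∣py∣≤7 (ℕP.m≤m+n 22 n)

labelling-isPrimitive : ∀ n → IsPrimitive (labelling n)
labelling-isPrimitive n =
  unitGap⇒isPrimitive (labelling-isLabelling n)
    (true ∷ false ∷ false ∷ false ∷ []) (true ∷ false ∷ true ∷ true ∷ []) refl

labelling-injective : ∀ m n → ¬ m ≡ n → ¬ (∀ v → labelling m v ≡ labelling n v)
labelling-injective m n m≢n same = m≢n (ℕP.+-cancelˡ-≡ 22 m n (ℤP.+-injective (begin
  + (22 ℕ.+ m)            ≡⟨ label-at-1-0 m ⟩
  labelling m unitPoint   ≡⟨ same unitPoint ⟩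
  labelling n unitPoint   ≡⟨ sym (label-at-1-0 n) ⟩
  + (22 ℕ.+ n)            ∎)))
  where
  open ≡-Reasoning
  unitPoint : V
  unitPoint = true ∷ true ∷ false ∷ false ∷ []
  label-at-1-0 : ∀ n → + (22 ℕ.+ n) ≡ labelling n unitPoint
  label-at-1-0 n = sym (trans (ℤP.+-identityʳ (1ℤ * + (22 ℕ.+ n))) (ℤP.*-identityˡ (+ (22 ℕ.+ n))))

mainTheorem9 : IsIntegralSumGraph × InfinitelyManyPrimitive
mainTheorem9 = (labelling 0 , labelling-isLabelling 0) , labelling , labelling-isPrimitive , labelling-injective
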